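{- Let $t\ge2$ be an integer and $h\in\mathbb Z$ coprime to $t$. For $0\le j\le t-1$ let $w_j:\mathbb Z\to\mathbb Z$ be given by $w_j(k)=k+h$ if $k\equiv (j-1)h-\tfrac12(t-1)(h-1)\pmod t$, $w_j(k)=k-h$ if $k\equiv jh-\tfrac12(t-1)(h-1)\pmod t$, and $w_j(k)=k$ otherwise. Then for every partition $\lambda$ and every $0\le j\le t-1$, there is a partition $\mu$ such that $w_j(X(\lambda))=X(\mu)$, where for a partition $\nu=(\nu_1\ge\nu_2\ge\cdots)$ (with $\nu_i=0$ for $i$ large) $X(\nu)=\{\nu_i-i: i\ge1\}$.
   Context: $w_j(X)$ denotes $\{w_j(x):x\in X\}$. (These maps are the level $h$ action of the affine Weyl group of type $\widetilde A_{t-1}$ on $\mathbb Z$; $\tfrac12(t-1)(h-1)$ is an integer since $h$ and $t$ are coprime.) -}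

module Defs where

open import Data.Nat as ℕ using (ℕ; zero; suc; NonZero; _≟_)
open import Data.Integer using (ℤ; +_; _+_; _-_; _*_)
open import Data.Integer.DivMod using (_/ℕ_; _%ℕ_)
open import Data.List using (List; []; _∷_)
open import Data.List.Relation.Unary.All using (All)
open import Data.List.Relation.Unary.Linked using (Linked)
open import Data.Product using (∃-syntax; _×_)
open import Relation.Binary.PropositionalEquality using (_≡_)
open import Relation.Nullary using (yes; no)

record Partition : Set where
  constructor mkPartition
  field
    parts      : List ℕ
    decreasing : Linked ℕ._≥_ parts
    positive   : All (ℕ._<_ 0) parts
open Partition public

-- ν_i for i ≥ 1, with the (1-indexed) index given as suc m; 0 beyond the length.
partAt : List ℕ → ℕ → ℕ
partAt []       _       = 0
partAt (x ∷ xs) zero    = x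
partAt (x ∷ xs) (suc m) = partAt xs m

_∈X_ : ℤ → Partition → Set
k ∈X ν = ∃[ m ] k ≡ + partAt (parts ν) m - + suc m

-- the integer ½ (t-1)(h-1)  (exact division: t, h coprime ⇒ not both even)
shift : ℕ → ℤ → ℤ
shift t h = ((+ t - + 1) * (h - + 1)) /ℕ 2

-- w_j(k) = k + h  if k ≡ (j-1)h - ½(t-1)(h-1)  (mod t)
--        = k - h  if k ≡ j h   - ½(t-1)(h-1)  (mod t)
--        = k      otherwise
-- (the two congruence classes are distinct when t ≥ 2 and gcd(h,t) = 1)
w : (t : ℕ) .{{_ : NonZero t}} → ℤ → ℕ → ℤ → ℤ
w t h j k with k %ℕ t ≟ (((+ j - + 1) * h - shift t h) %ℕ t)
... | yes _ = k + h
... | no  _ with k %ℕ t ≟ ((+ j * h - shift t h) %ℕ t)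
...   | yes _ = k - h
...   | no  _ = k

_∈wX[_,_,_]_ : ℤ → (t : ℕ) → .{{_ : NonZero t}} → ℤ → ℕ → Partition → Set
k ∈wX[ t , h , j ] λ' = ∃[ x ] (x ∈X λ') × (w t h j x ≡ k)

-- w_j adds h on the residue class a = (j-1)h - s and subtracts h on b = a + h, where s = (t-1)(h-1)/2;
-- since gcd(h, t) = 1 these classes are distinct, so w_j is an involution and w_j(X(λ)) is the set
-- {k | w_j(k) ∈ X(λ)}. Using X(c ∷ l) = {c - 1} ∪ (X(l) - 1) and the fact that shifting a and b by one
-- conjugates w_j by the shift k ↦ k + 1, this set is computed by induction on the parts of λ: each step
-- inserts one integer into the diagram of a partition, which again is the diagram of a partition.
-- In the base case X(∅) = {k < 0}, the image for h = n > 0 consists of all k < -n together with exactly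
-- one of i - n and i for every 0 ≤ i < n; the case h < 0 follows by exchanging the roles of a and b.

module Submission where

open import Data.Empty using (⊥-elim)
open import Data.Integer
  using (ℤ; +_; -[1+_]; _+_; _-_; _*_; -_; ∣_∣; _≤?_; _<?_; +≤+; +<+; -<+; pred)
  renaming (suc to sucℤ)
open import Data.Integer.DivMod using (_/ℕ_; _%ℕ_; a≡a%ℕn+[a/ℕn]*n; n%ℕd<d)
open import Data.Integer.Properties
  using ( +-injective; +-identityˡ; +-identityʳ; +-inverseʳ; +-comm; pos-+; pos-*; abs-*
        ; pred-suc; 0≤i⇒+∣i∣≡i; drop‿+<+; ≤-refl; ≤-reflexive; ≤-trans
        ; ≤-<-trans; ≤⇒≯; ≰⇒>; ≮⇒≥; ≤∧≢⇒<; +-monoˡ-<; i-j≤i; i≤i+j; i<j⇒suc[i]≤j; i<j⇒i≤pred[j])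
open import Data.Integer.Tactic.RingSolver using (solve-∀)
open import Data.List using (List; []; _∷_; filter)
open import Data.List.Relation.Unary.All.Properties using (all-filter)
open import Data.List.Relation.Unary.Linked using (Linked; []; [-]; _∷_; tail)
import Data.List.Relation.Unary.Linked.Properties as Linked
open import Data.Nat as ℕ using (ℕ; zero; suc; NonZero; z≤n; s≤s; z<s)
open import Data.Nat.Coprimality using (Coprime)
open import Data.Nat.Divisibility using (_∣_; divides; ∣-refl)
import Data.Nat.Properties as ℕ
open import Data.Product using (∃-syntax; _×_; _,_)
open import Data.Sum as Sum using (_⊎_; inj₁; inj₂)
open import Data.Sum.Function.Propositional using (_⊎-⇔_)
open import Function.Base using (_∘_; flip)
open import Function.Bundles using (_⇔_; mk⇔; Equivalence)
import Function.Properties.Equivalence as ⇔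
open import Function.Related.Propositional using (module EquationalReasoning)
open import Relation.Binary.PropositionalEquality
open import Relation.Nullary using (¬_; Dec; yes; no)
open import Relation.Nullary.Decidable using (map′)
open import Relation.Nullary.Negation using (contradiction)

open import Defs

open Equivalence using (to; from)

sucℤ-≡⇔ : ∀ {x y} → (sucℤ x ≡ sucℤ y) ⇔ (x ≡ y)
sucℤ-≡⇔ {x} {y} = mk⇔ (λ eq → trans (sym (pred-suc x)) (trans (cong pred eq) (pred-suc y))) (cong sucℤ)

≡-1⇔suc≡ : ∀ {k x} → (k ≡ x - + 1) ⇔ (sucℤ k ≡ x)
≡-1⇔suc≡ {k} {x} = mk⇔
  (λ eq → trans (cong sucℤ eq) (suc-sub x))
  (λ eq → trans (sub-suc k) (cong (_- + 1) eq))
  where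
  suc-sub : ∀ x → + 1 + (x - + 1) ≡ x
  suc-sub = solve-∀
  sub-suc : ∀ k → k ≡ + 1 + k - + 1
  sub-suc = solve-∀

+-cancelʳ-≡⇔ : ∀ {x y} z → (x + z ≡ y + z) ⇔ (x ≡ y)
+-cancelʳ-≡⇔ {x} {y} z = mk⇔
  (λ eq → trans (add-sub x z) (trans (cong (_- z) eq) (sym (add-sub y z))))
  (cong (_+ z))
  where
  add-sub : ∀ x z → x ≡ x + z - z
  add-sub = solve-∀

+-≡⇔≡- : ∀ {x y} z → (x + z ≡ y) ⇔ (x ≡ y - z)
+-≡⇔≡- {x} {y} z = subst (λ w → (x + z ≡ w) ⇔ (x ≡ y - z)) (sub-add y z) (+-cancelʳ-≡⇔ z)
  where
  sub-add : ∀ y z → y - z + z ≡ y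
  sub-add = solve-∀

⊎-leftSwap : ∀ {A B C : Set} → (A ⊎ (B ⊎ C)) ⇔ (B ⊎ (A ⊎ C))
⊎-leftSwap = mk⇔ leftSwap leftSwap
  where
  leftSwap : ∀ {A B C : Set} → A ⊎ (B ⊎ C) → B ⊎ (A ⊎ C)
  leftSwap = Sum.assocʳ ∘ Sum.map₁ Sum.swap ∘ Sum.assocˡ

∃<suc⇔ : ∀ {P : ℕ → Set} r → (∃[ i ] i ℕ.< suc r × P i) ⇔ (P r ⊎ ∃[ i ] i ℕ.< r × P i)
∃<suc⇔ {P} r = mk⇔ split join
  where
  split : (∃[ i ] i ℕ.< suc r × P i) → P r ⊎ ∃[ i ] i ℕ.< r × P i
  split (i , s≤s i≤r , Pi) with ℕ.m≤n⇒m<n∨m≡n i≤r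
  ... | inj₁ i<r  = inj₂ (i , i<r , Pi)
  ... | inj₂ refl = inj₁ Pi
  join : P r ⊎ (∃[ i ] i ℕ.< r × P i) → ∃[ i ] i ℕ.< suc r × P i
  join (inj₁ Pr)              = r , ℕ.n<1+n r , Pr
  join (inj₂ (i , i<r , Pi)) = i , ℕ.m<n⇒m<1+n i<r , Pi

involution-≡⇔ : ∀ {A : Set} {f : A → A} → (∀ x → f (f x) ≡ x) →
                ∀ {x y} → (f x ≡ y) ⇔ (x ≡ f y)
involution-≡⇔ {f = f} f-inv {x} = mk⇔
  (λ fx≡y → trans (sym (f-inv x)) (cong f fx≡y))
  (λ x≡fy → trans (cong f x≡fy) (f-inv _))

involution-image : ∀ {A : Set} {P : A → Set} {f : A → A} → (∀ x → f (f x) ≡ x) →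
                   ∀ k → (∃[ x ] P x × f x ≡ k) ⇔ P (f k)
involution-image {P = P} {f} f-inv k = mk⇔
  (λ (x , Px , fx≡k) → subst P (trans (sym (f-inv x)) (cong f fx≡k)) Px)
  (λ Pfk → f k , Pfk , f-inv k)

module Congruence (t : ℕ) .{{_ : NonZero t}} where

  infix 4 _≡ₘ_ _≡ₘ?_

  -- A record rather than the bare equation, so that x and y can be inferred from a proof.
  record _≡ₘ_ (x y : ℤ) : Set where
    constructor mk≡ₘ
    field residues-≡ : x %ℕ t ≡ y %ℕ t
  open _≡ₘ_ public

  _≡ₘ?_ : ∀ x y → Dec (x ≡ₘ y)
  x ≡ₘ? y = map′ mk≡ₘ residues-≡ (x %ℕ t ℕ.≟ y %ℕ t)

  ≡⇒≡ₘ : ∀ {x y} → x ≡ y → x ≡ₘ y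
  ≡⇒≡ₘ x≡y = mk≡ₘ (cong (_%ℕ t) x≡y)

  ≡ₘ-sym : ∀ {x y} → x ≡ₘ y → y ≡ₘ x
  ≡ₘ-sym (mk≡ₘ eq) = mk≡ₘ (sym eq)

  ≡ₘ-trans : ∀ {x y z} → x ≡ₘ y → y ≡ₘ z → x ≡ₘ z
  ≡ₘ-trans (mk≡ₘ eq) (mk≡ₘ eq′) = mk≡ₘ (trans eq eq′)

  residue+multiple≢residue : ∀ r s n → r ℕ.< t → + r ≢ + s + + suc n * + t
  residue+multiple≢residue r s n r<t eq = ℕ.<⇒≱ r<t (begin
      t                   ≤⟨ ℕ.m≤m+n t (n ℕ.* t) ⟩
      suc n ℕ.* t         ≤⟨ ℕ.m≤n+m _ s ⟩
      s ℕ.+ suc n ℕ.* t   ≡⟨ +-injective s+[1+n]t≡r ⟩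
      r                   ∎)
    where
    open ℕ.≤-Reasoning
    s+[1+n]t≡r : + (s ℕ.+ suc n ℕ.* t) ≡ + r
    s+[1+n]t≡r = trans (pos-+ s _) (trans (cong (_+_ (+ s)) (pos-* (suc n) t)) (sym eq))

  residue-unique : ∀ {r s} d → r ℕ.< t → s ℕ.< t → + r ≡ + s + d * + t → r ≡ s
  residue-unique {r} {s} (+ zero)  _   _   eq = +-injective (trans eq (+-identityʳ (+ s)))
  residue-unique {r} {s} (+ suc n) r<t _   eq = contradiction eq (residue+multiple≢residue r s n r<t)
  residue-unique {r} {s} -[1+ n ]  _   s<t eq = ⊥-elim (residue+multiple≢residue s r n s<t (begin
      + s                                          ≡⟨ add-cancel (+ s) -[1+ n ] (+ t) ⟩
      (+ s + -[1+ n ] * + t) + - -[1+ n ] * + t    ≡⟨ cong (λ z → z + + suc n * + t) eq ⟨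
      + r + + suc n * + t                          ∎))
    where
    open ≡-Reasoning
    add-cancel : ∀ x d m → x ≡ (x + d * m) + - d * m
    add-cancel = solve-∀

  %ℕ-unique : ∀ {x r} q → r ℕ.< t → x ≡ + r + q * + t → x %ℕ t ≡ r
  %ℕ-unique {x} {r} q r<t x≡r+qt = residue-unique (q - x /ℕ t) (n%ℕd<d x t) r<t
    (move-multiple (+ (x %ℕ t)) (x /ℕ t) (+ r) q (+ t) (trans (sym (a≡a%ℕn+[a/ℕn]*n x t)) x≡r+qt))
    where
    move-multiple : ∀ r′ d r q m → r′ + d * m ≡ r + q * m → r′ ≡ r + (q - d) * m
    move-multiple r′ d r q m eq = begin
      r′                     ≡⟨ add-sub r′ (d * m) ⟩
      (r′ + d * m) - d * m   ≡⟨ cong (_- d * m) eq ⟩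
      (r + q * m) - d * m    ≡⟨ regroup r q d m ⟩
      r + (q - d) * m        ∎
      where
      open ≡-Reasoning
      add-sub : ∀ x y → x ≡ x + y - y
      add-sub = solve-∀
      regroup : ∀ r q d m → r + q * m - d * m ≡ r + (q - d) * m
      regroup = solve-∀

  +-multiple-≡ₘ : ∀ x q → x + q * + t ≡ₘ x
  +-multiple-≡ₘ x q = mk≡ₘ (%ℕ-unique (x /ℕ t + q) (n%ℕd<d x t)
    (trans (cong (_+ q * + t) (a≡a%ℕn+[a/ℕn]*n x t)) (regroup (+ (x %ℕ t)) (x /ℕ t) q (+ t))))
    where
    regroup : ∀ r d q m → r + d * m + q * m ≡ r + (d + q) * m
    regroup = solve-∀

  ≡ₘ⇒≡+multiple : ∀ {x y} → x ≡ₘ y → ∃[ q ] x ≡ y + q * + t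
  ≡ₘ⇒≡+multiple {x} {y} (mk≡ₘ eq) = x /ℕ t - y /ℕ t , (begin
      x                                                      ≡⟨ a≡a%ℕn+[a/ℕn]*n x t ⟩
      + (x %ℕ t) + x /ℕ t * + t
        ≡⟨ cong (λ r → + r + x /ℕ t * + t) eq ⟩
      + (y %ℕ t) + x /ℕ t * + t
        ≡⟨ regroup (+ (y %ℕ t)) (x /ℕ t) (y /ℕ t) (+ t) ⟩
      (+ (y %ℕ t) + y /ℕ t * + t) + (x /ℕ t - y /ℕ t) * + t
        ≡⟨ cong (_+ (x /ℕ t - y /ℕ t) * + t) (a≡a%ℕn+[a/ℕn]*n y t) ⟨
      y + (x /ℕ t - y /ℕ t) * + t                            ∎)
    where
    open ≡-Reasoning
    regroup : ∀ r d e m → r + d * m ≡ (r + e * m) + (d - e) * m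
    regroup = solve-∀

  +-congʳ-≡ₘ : ∀ {x y} z → x ≡ₘ y → x + z ≡ₘ y + z
  +-congʳ-≡ₘ {x} {y} z x≡ₘy with ≡ₘ⇒≡+multiple x≡ₘy
  ... | q , x≡y+qt =
    ≡ₘ-trans (≡⇒≡ₘ (trans (cong (_+ z) x≡y+qt) (regroup y q (+ t) z))) (+-multiple-≡ₘ (y + z) q)
    where
    regroup : ∀ y q m z → y + q * m + z ≡ y + z + q * m
    regroup = solve-∀

  +-congˡ-≡ₘ : ∀ {x y} z → x ≡ₘ y → z + x ≡ₘ z + y
  +-congˡ-≡ₘ {x} {y} z x≡ₘy =
    ≡ₘ-trans (≡⇒≡ₘ (+-comm z x)) (≡ₘ-trans (+-congʳ-≡ₘ z x≡ₘy) (≡⇒≡ₘ (+-comm y z)))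

  +-cancelˡ-≡ₘ : ∀ {x y} z → z + x ≡ₘ z + y → x ≡ₘ y
  +-cancelˡ-≡ₘ {x} {y} z eq =
    ≡ₘ-trans (≡⇒≡ₘ (neg-add z x)) (≡ₘ-trans (+-congˡ-≡ₘ (- z) eq) (≡⇒≡ₘ (sym (neg-add z y))))
    where
    neg-add : ∀ z x → x ≡ - z + (z + x)
    neg-add = solve-∀

  +-≡ₘ-self⇒∣ : ∀ x h → x + h ≡ₘ x → t ∣ ∣ h ∣
  +-≡ₘ-self⇒∣ x h eq with ≡ₘ⇒≡+multiple eq
  ... | q , x+h≡x+qt = divides ∣ q ∣ (trans (cong ∣_∣ h≡qt) (abs-* q (+ t)))
    where
    sub-add : ∀ x y → y ≡ x + y - x
    sub-add = solve-∀
    h≡qt : h ≡ q * + t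
    h≡qt = trans (sub-add x h) (trans (cong (_- x) x+h≡x+qt) (sym (sub-add x (q * + t))))

  coprime⇒+-≢ₘ-self : 2 ℕ.≤ t → ∀ {h} → Coprime ∣ h ∣ t → ∀ x → ¬ x + h ≡ₘ x
  coprime⇒+-≢ₘ-self 2≤t {h} cop x eq = ℕ.<⇒≢ 2≤t (sym (cop (+-≡ₘ-self⇒∣ x h eq , ∣-refl)))

module Swap (t : ℕ) .{{_ : NonZero t}} where
  open Congruence t

  swap : (h a b : ℤ) → ℤ → ℤ
  swap h a b k with k %ℕ t ℕ.≟ a %ℕ t
  ... | yes _ = k + h
  ... | no  _ with k %ℕ t ℕ.≟ b %ℕ t
  ...   | yes _ = k - h
  ...   | no  _ = k

  data SwapView (h a b k : ℤ) : ℤ → Set where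
    at-a  : k ≡ₘ a → SwapView h a b k (k + h)
    at-b  : ¬ k ≡ₘ a → k ≡ₘ b → SwapView h a b k (k - h)
    fixed : ¬ k ≡ₘ a → ¬ k ≡ₘ b → SwapView h a b k k

  swap-view : ∀ h a b k → SwapView h a b k (swap h a b k)
  swap-view h a b k with k %ℕ t ℕ.≟ a %ℕ t
  ... | yes ka = at-a (mk≡ₘ ka)
  ... | no ¬ka with k %ℕ t ℕ.≟ b %ℕ t
  ...   | yes kb  = at-b (¬ka ∘ residues-≡) (mk≡ₘ kb)
  ...   | no  ¬kb = fixed (¬ka ∘ residues-≡) (¬kb ∘ residues-≡)

  module _ {h a b k : ℤ} where

    swap-at-a : k ≡ₘ a → swap h a b k ≡ k + h
    swap-at-a ka with swap h a b k | swap-view h a b k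
    ... | _ | at-a _      = refl
    ... | _ | at-b ¬ka _  = contradiction ka ¬ka
    ... | _ | fixed ¬ka _ = contradiction ka ¬ka

    swap-at-b : ¬ k ≡ₘ a → k ≡ₘ b → swap h a b k ≡ k - h
    swap-at-b ¬ka kb with swap h a b k | swap-view h a b k
    ... | _ | at-a ka     = contradiction ka ¬ka
    ... | _ | at-b _ _    = refl
    ... | _ | fixed _ ¬kb = contradiction kb ¬kb

    swap-fixed : ¬ k ≡ₘ a → ¬ k ≡ₘ b → swap h a b k ≡ k
    swap-fixed ¬ka ¬kb with swap h a b k | swap-view h a b k
    ... | _ | at-a ka   = contradiction ka ¬ka
    ... | _ | at-b _ kb = contradiction kb ¬kb
    ... | _ | fixed _ _ = refl

  swap-suc : ∀ h a b k → swap h (sucℤ a) (sucℤ b) (sucℤ k) ≡ sucℤ (swap h a b k)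
  swap-suc h a b k with swap h a b k | swap-view h a b k
  ... | _ | at-a ka = trans (swap-at-a (+-congˡ-≡ₘ (+ 1) ka)) (assoc (+ 1) k h)
    where
    assoc : ∀ x y z → x + y + z ≡ x + (y + z)
    assoc = solve-∀
  ... | _ | at-b ¬ka kb =
    trans (swap-at-b (¬ka ∘ +-cancelˡ-≡ₘ (+ 1)) (+-congˡ-≡ₘ (+ 1) kb)) (assoc (+ 1) k h)
    where
    assoc : ∀ x y z → x + y - z ≡ x + (y - z)
    assoc = solve-∀
  ... | _ | fixed ¬ka ¬kb = swap-fixed (¬ka ∘ +-cancelˡ-≡ₘ (+ 1)) (¬kb ∘ +-cancelˡ-≡ₘ (+ 1))

  record IsSwap (h a b : ℤ) : Set where
    field
      b≡ₘa+h : b ≡ₘ a + h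
      a≢ₘb   : ¬ a ≡ₘ b

  module _ {h a b : ℤ} (S : IsSwap h a b) where
    open IsSwap S

    ≡ₘa⇒+h≡ₘb : ∀ {k} → k ≡ₘ a → k + h ≡ₘ b
    ≡ₘa⇒+h≡ₘb ka = ≡ₘ-trans (+-congʳ-≡ₘ h ka) (≡ₘ-sym b≡ₘa+h)

    ≡ₘb⇒-h≡ₘa : ∀ {k} → k ≡ₘ b → k - h ≡ₘ a
    ≡ₘb⇒-h≡ₘa {k} kb = ≡ₘ-trans (+-congʳ-≡ₘ (- h) (≡ₘ-trans kb b≡ₘa+h)) (≡⇒≡ₘ (add-sub a h))
      where
      add-sub : ∀ x y → x + y - y ≡ x
      add-sub = solve-∀

    ≡ₘb⇒≢ₘa : ∀ {k} → k ≡ₘ b → ¬ k ≡ₘ a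
    ≡ₘb⇒≢ₘa kb ka = a≢ₘb (≡ₘ-trans (≡ₘ-sym ka) kb)

    swap-involutive : ∀ k → swap h a b (swap h a b k) ≡ k
    swap-involutive k with swap h a b k | swap-view h a b k
    ... | _ | at-a ka =
      trans (swap-at-b (≡ₘb⇒≢ₘa (≡ₘa⇒+h≡ₘb ka)) (≡ₘa⇒+h≡ₘb ka)) (add-sub k h)
      where
      add-sub : ∀ x y → x + y - y ≡ x
      add-sub = solve-∀
    ... | _ | at-b _ kb = trans (swap-at-a (≡ₘb⇒-h≡ₘa kb)) (sub-add k h)
      where
      sub-add : ∀ x y → x - y + y ≡ x
      sub-add = solve-∀
    ... | _ | fixed ¬ka ¬kb = swap-fixed ¬ka ¬kb

    swap-neg : ∀ k → swap h a b k ≡ swap (- h) b a k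
    swap-neg k with swap h a b k | swap-view h a b k
    ... | _ | at-a ka       = sym (trans (swap-at-b (λ kb → ≡ₘb⇒≢ₘa kb ka) ka) (sub-neg k h))
      where
      sub-neg : ∀ x y → x - - y ≡ x + y
      sub-neg = solve-∀
    ... | _ | at-b _ kb     = sym (swap-at-a kb)
    ... | _ | fixed ¬ka ¬kb = sym (swap-fixed ¬kb ¬ka)

    IsSwap-neg : IsSwap (- h) b a
    IsSwap-neg = record
      { b≡ₘa+h = ≡ₘ-sym (≡ₘb⇒-h≡ₘa {b} (mk≡ₘ refl))
      ; a≢ₘb   = a≢ₘb ∘ ≡ₘ-sym
      }

    IsSwap-suc : IsSwap h (sucℤ a) (sucℤ b)
    IsSwap-suc = record
      { b≡ₘa+h = ≡ₘ-trans (+-congˡ-≡ₘ (+ 1) b≡ₘa+h) (≡⇒≡ₘ (assoc (+ 1) a h))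
      ; a≢ₘb   = a≢ₘb ∘ +-cancelˡ-≡ₘ (+ 1)
      }
      where
      assoc : ∀ x y z → x + (y + z) ≡ x + y + z
      assoc = solve-∀

module MayaDiagrams where
  open import Data.Integer using (_≤_; _<_)

  Decreasing : List ℕ → Set
  Decreasing = Linked ℕ._≥_

  infix 4 _∈Xˡ_

  record _∈Xˡ_ (k : ℤ) (l : List ℕ) : Set where
    constructor at
    field
      index   : ℕ
      ≡-index : k ≡ + partAt l index - + suc index

  partAt-≤-head : ∀ {c l} → Decreasing (c ∷ l) → ∀ m → partAt l m ℕ.≤ c
  partAt-≤-head {l = []}    _          _       = z≤n
  partAt-≤-head {l = _ ∷ _} (c≥d ∷ _)  zero    = c≥d
  partAt-≤-head {l = _ ∷ _} (c≥d ∷ ds) (suc m) = ℕ.≤-trans (partAt-≤-head ds m) c≥d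

  ∷-decreasing : ∀ {c l} → partAt l 0 ℕ.≤ c → Decreasing l → Decreasing (c ∷ l)
  ∷-decreasing _   []       = [-]
  ∷-decreasing d≤c [-]      = d≤c ∷ [-]
  ∷-decreasing d≤c (p ∷ ps) = d≤c ∷ p ∷ ps

  ∈Xˡ-∷ : ∀ {c l} k → k ∈Xˡ c ∷ l ⇔ (sucℤ k ≡ + c ⊎ sucℤ k ∈Xˡ l)
  ∈Xˡ-∷ {c} {l} k = mk⇔ split join
    where
    shift-index : ∀ p m → + p - + suc (suc m) ≡ (+ p - + suc m) - + 1
    shift-index p m = reassoc (+ p) (+ suc m)
      where
      reassoc : ∀ x y → x - (+ 1 + y) ≡ x - y - + 1
      reassoc = solve-∀
    split : k ∈Xˡ c ∷ l → sucℤ k ≡ + c ⊎ sucℤ k ∈Xˡ l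
    split (at zero    eq) = inj₁ (to ≡-1⇔suc≡ eq)
    split (at (suc m) eq) = inj₂ (at m (to ≡-1⇔suc≡ (trans eq (shift-index (partAt l m) m))))
    join : sucℤ k ≡ + c ⊎ sucℤ k ∈Xˡ l → k ∈Xˡ c ∷ l
    join (inj₁ eq)        = at zero (from ≡-1⇔suc≡ eq)
    join (inj₂ (at m eq)) = at (suc m) (trans (from ≡-1⇔suc≡ eq) (sym (shift-index (partAt l m) m)))

  ∈Xˡ-∷-∣∣ : ∀ {x l} → + 0 ≤ x → ∀ k → k ∈Xˡ ∣ x ∣ ∷ l ⇔ (sucℤ k ≡ x ⊎ sucℤ k ∈Xˡ l)
  ∈Xˡ-∷-∣∣ {x} 0≤x k rewrite sym (0≤i⇒+∣i∣≡i 0≤x) = ∈Xˡ-∷ k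

  negative∈Xˡ : ∀ {l} → (∀ m → partAt l m ≡ 0) → ∀ {k} → k < + 0 → k ∈Xˡ l
  negative∈Xˡ zeros {+ n}      (+<+ ())
  negative∈Xˡ zeros { -[1+ m ]} _ = at m (cong (λ p → + p - + suc m) (sym (zeros m)))

  ∈Xˡ[]⇔negative : ∀ {k} → k ∈Xˡ [] ⇔ k < + 0
  ∈Xˡ[]⇔negative = mk⇔ (λ { (at _ refl) → -<+ }) (negative∈Xˡ {[]} (λ _ → refl))

  head∉Xˡ-tail : ∀ {c l} → Decreasing (c ∷ l) → ¬ + c ∈Xˡ l
  head∉Xˡ-tail {c} {l} dec (at m eq) = ℕ.<⇒≱ (ℕ.m<m+n c z<s) (begin
      c ℕ.+ suc m   ≡⟨ +-injective (trans (cong (_+ + suc m) eq) (sub-add (+ partAt l m) (+ suc m))) ⟩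
      partAt l m    ≤⟨ partAt-≤-head dec m ⟩
      c             ∎)
    where
    open ℕ.≤-Reasoning
    sub-add : ∀ x y → x - y + y ≡ x
    sub-add = solve-∀

  zero-head⇒zeros : ∀ {l} → Decreasing (0 ∷ l) → ∀ m → partAt (0 ∷ l) m ≡ 0
  zero-head⇒zeros dec zero    = refl
  zero-head⇒zeros dec (suc m) = ℕ.n≤0⇒n≡0 (partAt-≤-head dec m)

  ∉Xˡ⇒nonnegative : ∀ {l x} → (∀ m → partAt l m ≡ 0) → ¬ x ∈Xˡ l → + 0 ≤ x
  ∉Xˡ⇒nonnegative {x = x} zeros x∉ with + 0 ≤? x
  ... | yes 0≤x = 0≤x
  ... | no  0≰x = contradiction (negative∈Xˡ zeros (≰⇒> 0≰x)) x∉

  ∣∣-≤ : ∀ {x b} → + 0 ≤ x → x ≤ + b → ∣ x ∣ ℕ.≤ b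
  ∣∣-≤ {+ _} _ (+≤+ x≤b) = x≤b

  +≤⇒≤∣∣ : ∀ {c x} → + c ≤ x → c ℕ.≤ ∣ x ∣
  +≤⇒≤∣∣ (+≤+ c≤x) = c≤x

  ∉Xˡ-below-head : ∀ {x c l} → ¬ + suc c ≤ x → ¬ x ∈Xˡ suc c ∷ l → sucℤ x ≤ + c
  ∉Xˡ-below-head {x} c≰x x∉ = i<j⇒suc[i]≤j (≤∧≢⇒< (i<j⇒i≤pred[j] (≰⇒> c≰x)) x≢c)
    where
    x≢c : x ≢ _
    x≢c x≡c = x∉ (from (∈Xˡ-∷ x) (inj₁ (cong sucℤ x≡c)))

  insert : ℤ → List ℕ → List ℕ
  insert x []      = ∣ x ∣ ∷ []
  insert x (c ∷ l) with + c ≤? x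
  ... | yes _ = ∣ x ∣ ∷ c ∷ l
  ... | no  _ = c ℕ.∸ 1 ∷ insert (sucℤ x) l

  insert-head-≤ : ∀ {x} l b → partAt l 0 ℕ.≤ suc b → x ≤ + b → ¬ x ∈Xˡ l → partAt (insert x l) 0 ℕ.≤ b
  insert-head-≤ [] b _ x≤b x∉ = ∣∣-≤ (∉Xˡ⇒nonnegative {[]} (λ _ → refl) x∉) x≤b
  insert-head-≤ {x} (c ∷ l) b c≤1+b x≤b x∉ with + c ≤? x
  ... | yes c≤x = ∣∣-≤ (≤-trans (+≤+ z≤n) c≤x) x≤b
  ... | no  _   = ℕ.∸-monoˡ-≤ 1 c≤1+b

  insert-decreasing : ∀ {x} l → Decreasing l → ¬ x ∈Xˡ l → Decreasing (insert x l)
  insert-decreasing []      _   _  = [-]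
  insert-decreasing {x} (c ∷ l) dec x∉ with + c ≤? x
  ... | yes c≤x = ∷-decreasing (+≤⇒≤∣∣ c≤x) dec
  insert-decreasing {x} (zero ∷ l) dec x∉ | no c≰x =
    contradiction (∉Xˡ⇒nonnegative (zero-head⇒zeros dec) x∉) c≰x
  insert-decreasing {x} (suc c ∷ l) dec x∉ | no c≰x =
    ∷-decreasing (insert-head-≤ l c (partAt-≤-head dec 0) (∉Xˡ-below-head c≰x x∉) 1+x∉)
                 (insert-decreasing l (tail dec) 1+x∉)
    where
    1+x∉ : ¬ sucℤ x ∈Xˡ l
    1+x∉ = x∉ ∘ from (∈Xˡ-∷ x) ∘ inj₂

  ∈Xˡ-insert : ∀ {x} l → Decreasing l → ¬ x ∈Xˡ l → ∀ k → k ∈Xˡ insert x l ⇔ (sucℤ k ≡ x ⊎ sucℤ k ∈Xˡ l)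
  ∈Xˡ-insert [] _ x∉ = ∈Xˡ-∷-∣∣ (∉Xˡ⇒nonnegative {[]} (λ _ → refl) x∉)
  ∈Xˡ-insert {x} (c ∷ l) dec x∉ with + c ≤? x
  ... | yes c≤x = ∈Xˡ-∷-∣∣ (≤-trans (+≤+ z≤n) c≤x)
  ∈Xˡ-insert {x} (zero ∷ l) dec x∉ | no c≰x =
    contradiction (∉Xˡ⇒nonnegative (zero-head⇒zeros dec) x∉) c≰x
  ∈Xˡ-insert {x} (suc c ∷ l) dec x∉ | no c≰x = λ k → begin
    k ∈Xˡ c ∷ insert (sucℤ x) l
      ∼⟨ ∈Xˡ-∷ k ⟩
    (sucℤ k ≡ + c ⊎ sucℤ k ∈Xˡ insert (sucℤ x) l)
      ∼⟨ ⇔.refl ⊎-⇔ ∈Xˡ-insert l (tail dec) 1+x∉ (sucℤ k) ⟩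
    (sucℤ k ≡ + c ⊎ (sucℤ (sucℤ k) ≡ sucℤ x ⊎ sucℤ (sucℤ k) ∈Xˡ l))
      ∼⟨ ⊎-leftSwap ⟩
    (sucℤ (sucℤ k) ≡ sucℤ x ⊎ (sucℤ k ≡ + c ⊎ sucℤ (sucℤ k) ∈Xˡ l))
      ∼⟨ sucℤ-≡⇔ ⊎-⇔ (⇔.sym sucℤ-≡⇔ ⊎-⇔ ⇔.refl) ⟩
    (sucℤ k ≡ x ⊎ (sucℤ (sucℤ k) ≡ + suc c ⊎ sucℤ (sucℤ k) ∈Xˡ l))
      ∼⟨ ⇔.sym (⇔.refl ⊎-⇔ ∈Xˡ-∷ (sucℤ k)) ⟩
    (sucℤ k ≡ x ⊎ sucℤ k ∈Xˡ suc c ∷ l)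
      ∎
    where
    open EquationalReasoning
    1+x∉ : ¬ sucℤ x ∈Xˡ l
    1+x∉ = x∉ ∘ from (∈Xˡ-∷ x) ∘ inj₂

  partAt-filter-positive : ∀ {l} → Decreasing l → ∀ m → partAt (filter (0 ℕ.<?_) l) m ≡ partAt l m
  partAt-filter-positive {[]}        _   _       = refl
  partAt-filter-positive {zero ∷ l}  dec m       =
    trans (partAt-filter-positive (tail dec) m)
          (trans (ℕ.n≤0⇒n≡0 (partAt-≤-head dec m)) (sym (zero-head⇒zeros dec m)))
  partAt-filter-positive {suc _ ∷ _} _   zero    = refl
  partAt-filter-positive {suc _ ∷ _} dec (suc m) = partAt-filter-positive (tail dec) m

  toPartition : ∀ l → Decreasing l → Partition
  toPartition l dec = mkPartition
    (filter (0 ℕ.<?_) l)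
    (Linked.filter⁺ (0 ℕ.<?_) (flip ℕ.≤-trans) dec)
    (all-filter (0 ℕ.<?_) l)

  ∈X⇔∈Xˡ : ∀ {k ν} → k ∈X ν ⇔ k ∈Xˡ parts ν
  ∈X⇔∈Xˡ = mk⇔ (λ (m , eq) → at m eq) (λ (at m eq) → m , eq)

  ∈X-toPartition : ∀ {l} (dec : Decreasing l) k → k ∈X toPartition l dec ⇔ k ∈Xˡ l
  ∈X-toPartition {l} dec k = mk⇔
    (λ (m , eq) → at m (trans eq (cong (λ p → + p - + suc m) (partAt-filter-positive dec m))))
    (λ (at m eq) → m , trans eq (cong (λ p → + p - + suc m) (sym (partAt-filter-positive dec m))))

  record IsShiftedX (c : ℕ) (S : ℤ → Set) : Set where
    constructor shiftedX
    field
      base            : List ℕ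
      base-decreasing : Decreasing base
      ∈⇔∈Xˡ           : ∀ k → S k ⇔ k + + c ∈Xˡ base

  IsShiftedX-cong : ∀ {c S T} → (∀ k → S k ⇔ T k) → IsShiftedX c S → IsShiftedX c T
  IsShiftedX-cong S⇔T (shiftedX l dec S⇔X) = shiftedX l dec (λ k → ⇔.trans (⇔.sym (S⇔T k)) (S⇔X k))

  IsShiftedX-negatives : ∀ c → IsShiftedX c (λ k → k + + c < + 0)
  IsShiftedX-negatives c = shiftedX [] [] (λ _ → ⇔.sym ∈Xˡ[]⇔negative)

  IsShiftedX-suc : ∀ {c S} → IsShiftedX c S → IsShiftedX (suc c) (λ k → S (sucℤ k))
  IsShiftedX-suc {c} (shiftedX l dec S⇔X) = shiftedX l dec λ k →
    subst (λ z → _ ⇔ z ∈Xˡ l) (suc-+ k (+ c)) (S⇔X (sucℤ k))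
    where
    suc-+ : ∀ k c → + 1 + k + c ≡ k + (+ 1 + c)
    suc-+ = solve-∀

  IsShiftedX-insert : ∀ {c S y} → IsShiftedX (suc c) S → ¬ S y → IsShiftedX c (λ k → k ≡ y ⊎ S k)
  IsShiftedX-insert {c} {S} {y} (shiftedX l dec S⇔X) y∉S =
    shiftedX (insert (y + + suc c) l) (insert-decreasing l dec y∉X) λ k → ⇔.sym (begin
      k + + c ∈Xˡ insert (y + + suc c) l                      ∼⟨ ∈Xˡ-insert l dec y∉X (k + + c) ⟩
      (sucℤ (k + + c) ≡ y + + suc c ⊎ sucℤ (k + + c) ∈Xˡ l)   ≡⟨ cong (λ z → z ≡ _ ⊎ z ∈Xˡ l) (suc-+ k (+ c)) ⟩
      (k + + suc c ≡ y + + suc c ⊎ k + + suc c ∈Xˡ l)         ∼⟨ +-cancelʳ-≡⇔ _ ⊎-⇔ ⇔.sym (S⇔X k) ⟩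
      (k ≡ y ⊎ S k)                                           ∎)
    where
    open EquationalReasoning
    y∉X : ¬ y + + suc c ∈Xˡ l
    y∉X = y∉S ∘ from (S⇔X y)
    suc-+ : ∀ k c → + 1 + (k + c) ≡ k + (+ 1 + c)
    suc-+ = solve-∀

  IsShiftedX-zero⇒X : ∀ {S} → IsShiftedX 0 S → ∃[ μ ] (∀ k → S k ⇔ k ∈X μ)
  IsShiftedX-zero⇒X {S} (shiftedX l dec S⇔X) = toPartition l dec , λ k →
    ⇔.trans (subst (λ z → S k ⇔ z ∈Xˡ l) (+-identityʳ k) (S⇔X k)) (⇔.sym (∈X-toPartition dec k))

open MayaDiagrams

module SwapImage (t : ℕ) .{{_ : NonZero t}} where
  open import Data.Integer using (_≤_; _<_)
  open Congruence t
  open Swap t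

  +-cancelʳ-< : ∀ {x y} z → x + z < y + z → x < y
  +-cancelʳ-< {x} {y} z lt = subst₂ _<_ (add-sub x z) (add-sub y z) (+-monoˡ-< (- z) lt)
    where
    add-sub : ∀ x z → x + z - z ≡ x
    add-sub = solve-∀

  x<y⇒x-y<0 : ∀ {x y} → x < y → x - y < + 0
  x<y⇒x-y<0 {x} {y} x<y = subst (x - y <_) (+-inverseʳ y) (+-monoˡ-< (- y) x<y)

  x-y<0⇒x<y : ∀ {x y} → x - y < + 0 → x < y
  x-y<0⇒x<y {x} {y} lt = subst₂ _<_ (sub-add x y) (+-identityˡ y) (+-monoˡ-< y lt)
    where
    sub-add : ∀ x y → x - y + y ≡ x
    sub-add = solve-∀

  module ImageOfEmpty (n : ℕ) {a b : ℤ} (S : IsSwap (+ n) a b) where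

    swap-≤-+ : ∀ k → swap (+ n) a b k ≤ k + + n
    swap-≤-+ k with swap (+ n) a b k | swap-view (+ n) a b k
    ... | _ | at-a _    = ≤-refl
    ... | _ | at-b _ _  = ≤-trans (i-j≤i k (+ n)) (i≤i+j k (+ n))
    ... | _ | fixed _ _ = i≤i+j k (+ n)

    ≢ₘa⇒swap-≤ : ∀ {k} → ¬ k ≡ₘ a → swap (+ n) a b k ≤ k
    ≢ₘa⇒swap-≤ {k} ¬ka with swap (+ n) a b k | swap-view (+ n) a b k
    ... | _ | at-a ka   = contradiction ka ¬ka
    ... | _ | at-b _ _  = i-j≤i k (+ n)
    ... | _ | fixed _ _ = ≤-refl

    swap-negative⇒≡ₘb : ∀ {k} → + 0 ≤ k → swap (+ n) a b k < + 0 → k ≡ₘ b × k < + n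
    swap-negative⇒≡ₘb {k} 0≤k sw<0 with swap (+ n) a b k | swap-view (+ n) a b k
    ... | _ | at-a _    = contradiction sw<0 (≤⇒≯ (≤-trans 0≤k (i≤i+j k (+ n))))
    ... | _ | at-b _ kb = kb , x-y<0⇒x<y sw<0
    ... | _ | fixed _ _ = contradiction sw<0 (≤⇒≯ 0≤k)

    -- pick i - n is the element of the image lying in {i - n, i}; BaseImage r collects the
    -- first r of them together with all k < -n.
    pick : ℕ → ℕ
    pick i with + i ≡ₘ? b
    ... | yes _ = i ℕ.+ n
    ... | no  _ = i

    pick-≡ₘb : ∀ {i} → + i ≡ₘ b → pick i ≡ i ℕ.+ n
    pick-≡ₘb {i} ib with + i ≡ₘ? b
    ... | yes _   = refl
    ... | no  ¬ib = contradiction ib ¬ib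

    pick-≢ₘb : ∀ {i} → ¬ + i ≡ₘ b → pick i ≡ i
    pick-≢ₘb {i} ¬ib with + i ≡ₘ? b
    ... | yes ib = contradiction ib ¬ib
    ... | no  _  = refl

    pick-injective : ∀ {i j} → i ℕ.< n → j ℕ.< n → pick i ≡ pick j → i ≡ j
    pick-injective {i} {j} i<n j<n eq with + i ≡ₘ? b | + j ≡ₘ? b
    ... | yes _ | yes _ = ℕ.+-cancelʳ-≡ n i j eq
    ... | yes _ | no  _ = contradiction (subst (n ℕ.≤_) eq (ℕ.m≤n+m n i)) (ℕ.<⇒≱ j<n)
    ... | no  _ | yes _ = contradiction (subst (n ℕ.≤_) (sym eq) (ℕ.m≤n+m n j)) (ℕ.<⇒≱ i<n)
    ... | no  _ | no  _ = eq

    BaseImage : ℕ → ℤ → Set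
    BaseImage r k = k + + n < + 0 ⊎ ∃[ i ] i ℕ.< r × k + + n ≡ + pick i

    BaseImage-suc : ∀ r k → BaseImage (suc r) k ⇔ (k ≡ + pick r - + n ⊎ BaseImage r k)
    BaseImage-suc r k = begin
      (k + + n < + 0 ⊎ ∃[ i ] i ℕ.< suc r × k + + n ≡ + pick i)
        ∼⟨ ⇔.refl ⊎-⇔ ∃<suc⇔ r ⟩
      (k + + n < + 0 ⊎ (k + + n ≡ + pick r ⊎ ∃[ i ] i ℕ.< r × k + + n ≡ + pick i))
        ∼⟨ ⊎-leftSwap ⟩
      (k + + n ≡ + pick r ⊎ BaseImage r k)
        ∼⟨ +-≡⇔≡- (+ n) ⊎-⇔ ⇔.refl ⟩
      (k ≡ + pick r - + n ⊎ BaseImage r k)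
        ∎
      where open EquationalReasoning

    pick∉BaseImage : ∀ {r} → r ℕ.< n → ¬ BaseImage r (+ pick r - + n)
    pick∉BaseImage {r} r<n (inj₁ lt) = ≤⇒≯ (+≤+ z≤n) (subst (_< + 0) sub-add lt)
      where
      sub-add : + pick r - + n + + n ≡ + pick r
      sub-add = from (+-≡⇔≡- (+ n)) refl
    pick∉BaseImage {r} r<n (inj₂ (i , i<r , eq)) = ℕ.<-irrefl (sym r≡i) i<r
      where
      r≡i : r ≡ i
      r≡i = pick-injective r<n (ℕ.<-trans i<r r<n)
              (+-injective (trans (sym (from (+-≡⇔≡- (+ n)) refl)) eq))

    BaseImage-shifted : ∀ r c → r ℕ.+ c ≡ n → IsShiftedX c (BaseImage r)
    BaseImage-shifted zero    _ refl =
      IsShiftedX-cong (λ _ → mk⇔ inj₁ λ { (inj₁ neg) → neg ; (inj₂ (_ , () , _)) }) (IsShiftedX-negatives n)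
    BaseImage-shifted (suc r) c eq   = IsShiftedX-cong (λ k → ⇔.sym (BaseImage-suc r k))
      (IsShiftedX-insert (BaseImage-shifted r (suc c) (trans (ℕ.+-suc r c) eq)) (pick∉BaseImage r<n))
      where
      r<n : r ℕ.< n
      r<n = subst (suc r ℕ.≤_) eq (ℕ.m≤m+n (suc r) c)

    BaseImage⇒swap-negative : ∀ {k} → BaseImage n k → swap (+ n) a b k < + 0
    BaseImage⇒swap-negative {k} (inj₁ lt) = ≤-<-trans (swap-≤-+ k) lt
    BaseImage⇒swap-negative {k} (inj₂ (i , i<n , eq)) with + i ≡ₘ? b
    ... | yes ib = subst (λ z → swap (+ n) a b z < + 0) (sym k≡i)
                     (subst (_< + 0) (sym (swap-at-b (≡ₘb⇒≢ₘa S ib) ib)) (x<y⇒x-y<0 (+<+ i<n)))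
      where
      k≡i : k ≡ + i
      k≡i = to (+-cancelʳ-≡⇔ (+ n)) eq
    ... | no ¬ib = ≤-<-trans (≢ₘa⇒swap-≤ ¬ka) (+-cancelʳ-< (+ n) (subst (_< + n) (sym eq) (+<+ i<n)))
      where
      ¬ka : ¬ k ≡ₘ a
      ¬ka ka = ¬ib (subst (_≡ₘ b) eq (≡ₘa⇒+h≡ₘb S ka))

    index-of-negative : ∀ {k} → + 0 ≤ k + + n → k < + 0 → swap (+ n) a b k < + 0 →
                        ∃[ i ] i ℕ.< n × k + + n ≡ + pick i
    index-of-negative {k} 0≤k+n k<0 sw<0 =
      i , drop‿+<+ (subst (_< + n) (sym +i≡k+n) (+-monoˡ-< (+ n) k<0)) ,
      trans (sym +i≡k+n) (cong +_ (sym (pick-≢ₘb ¬ib)))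
      where
      i = ∣ k + + n ∣
      +i≡k+n : + i ≡ k + + n
      +i≡k+n = 0≤i⇒+∣i∣≡i 0≤k+n
      add-sub : ∀ x y → x + y - y ≡ x
      add-sub = solve-∀
      ¬ib : ¬ + i ≡ₘ b
      ¬ib ib = ≤⇒≯ (≤-trans 0≤k+n (≤-reflexive (sym (swap-at-a ka)))) sw<0
        where
        ka : k ≡ₘ a
        ka = ≡ₘ-trans (≡⇒≡ₘ (sym (add-sub k (+ n)))) (≡ₘb⇒-h≡ₘa S (subst (_≡ₘ b) +i≡k+n ib))

    index-of-nonnegative : ∀ {k} → + 0 ≤ k → swap (+ n) a b k < + 0 → ∃[ i ] i ℕ.< n × k + + n ≡ + pick i
    index-of-nonnegative {k} 0≤k sw<0 with swap-negative⇒≡ₘb 0≤k sw<0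
    ... | kb , k<n = ∣ k ∣ , drop‿+<+ (subst (_< + n) (sym +i≡k) k<n) ,
                     trans (cong (_+ + n) (sym +i≡k)) (cong +_ (sym (pick-≡ₘb ib)))
      where
      +i≡k : + ∣ k ∣ ≡ k
      +i≡k = 0≤i⇒+∣i∣≡i 0≤k
      ib : + ∣ k ∣ ≡ₘ b
      ib = subst (_≡ₘ b) (sym +i≡k) kb

    swap-negative⇒BaseImage : ∀ {k} → swap (+ n) a b k < + 0 → BaseImage n k
    swap-negative⇒BaseImage {k} sw<0 with k + + n <? + 0 | k <? + 0
    ... | yes k+n<0 | _       = inj₁ k+n<0
    ... | no  k+n≮0 | yes k<0 = inj₂ (index-of-negative (≮⇒≥ k+n≮0) k<0 sw<0)
    ... | no  _     | no  k≮0 = inj₂ (index-of-nonnegative (≮⇒≥ k≮0) sw<0)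

    BaseImage⇔swap∈X[] : ∀ k → BaseImage n k ⇔ swap (+ n) a b k ∈Xˡ []
    BaseImage⇔swap∈X[] k =
      ⇔.sym (⇔.trans ∈Xˡ[]⇔negative (mk⇔ (swap-negative⇒BaseImage {k}) (BaseImage⇒swap-negative {k})))

    swap-image-[] : IsShiftedX 0 (λ k → swap (+ n) a b k ∈Xˡ [])
    swap-image-[] = IsShiftedX-cong BaseImage⇔swap∈X[]
      (BaseImage-shifted n 0 (ℕ.+-identityʳ n))

  swap-∈Xˡ-∷ : ∀ {h a b c l} → IsSwap h a b → ∀ k →
               swap h a b k ∈Xˡ c ∷ l ⇔ (k ≡ swap h a b (+ c - + 1) ⊎ swap h (sucℤ a) (sucℤ b) (sucℤ k) ∈Xˡ l)
  swap-∈Xˡ-∷ {h} {a} {b} {c} {l} S k = begin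
    swap h a b k ∈Xˡ c ∷ l
      ∼⟨ ∈Xˡ-∷ (swap h a b k) ⟩
    (sucℤ (swap h a b k) ≡ + c ⊎ sucℤ (swap h a b k) ∈Xˡ l)
      ∼⟨ ⇔.trans (⇔.sym ≡-1⇔suc≡) (involution-≡⇔ {f = swap h a b} (swap-involutive S)) ⊎-⇔ ⇔.refl ⟩
    (k ≡ swap h a b (+ c - + 1) ⊎ sucℤ (swap h a b k) ∈Xˡ l)
      ≡⟨ cong (λ z → k ≡ swap h a b (+ c - + 1) ⊎ z ∈Xˡ l) (sym (swap-suc h a b k)) ⟩
    (k ≡ swap h a b (+ c - + 1) ⊎ swap h (sucℤ a) (sucℤ b) (sucℤ k) ∈Xˡ l)
      ∎
    where open EquationalReasoning

  swap-image : ∀ {h a b} → IsSwap h a b → ∀ l → Decreasing l → IsShiftedX 0 (λ k → swap h a b k ∈Xˡ l)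
  swap-image {+ n}               S []      _   = ImageOfEmpty.swap-image-[] n S
  swap-image { -[1+ n ]} {a} {b} S []      _   = IsShiftedX-cong
    (λ k → subst (λ z → z ∈Xˡ [] ⇔ swap -[1+ n ] a b k ∈Xˡ []) (swap-neg S k) ⇔.refl)
    (ImageOfEmpty.swap-image-[] (suc n) (IsSwap-neg S))
  swap-image {h} {a} {b}         S (c ∷ l) dec = IsShiftedX-cong (λ k → ⇔.sym (swap-∈Xˡ-∷ S k))
    (IsShiftedX-insert (IsShiftedX-suc (swap-image (IsSwap-suc S) l (tail dec))) y∉)
    where
    c-1 = + c - + 1
    y∉ : ¬ swap h (sucℤ a) (sucℤ b) (sucℤ (swap h a b c-1)) ∈Xˡ l
    y∉ = head∉Xˡ-tail dec ∘ subst (_∈Xˡ l)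
           (trans (swap-suc h a b (swap h a b c-1))
                  (trans (cong sucℤ (swap-involutive S c-1)) (to ≡-1⇔suc≡ refl)))

module _ (t : ℕ) .{{_ : NonZero t}} (h : ℤ) (j : ℕ) where
  open Congruence t
  open Swap t
  open SwapImage t

  private
    a b : ℤ
    a = (+ j - + 1) * h - shift t h
    b = + j * h - shift t h

  w≗swap : ∀ k → w t h j k ≡ swap h a b k
  w≗swap k with k %ℕ t ℕ.≟ a %ℕ t
  ... | yes _ = refl
  ... | no  _ with k %ℕ t ℕ.≟ b %ℕ t
  ...   | yes _ = refl
  ...   | no  _ = refl

  module _ (2≤t : 2 ℕ.≤ t) (cop : Coprime ∣ h ∣ t) where

    IsSwap-w : IsSwap h a b
    IsSwap-w = record
      { b≡ₘa+h = ≡⇒≡ₘ (regroup (+ j) h (shift t h))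
      ; a≢ₘb   = λ a≡ₘb → coprime⇒+-≢ₘ-self 2≤t cop a
                    (≡ₘ-trans (≡⇒≡ₘ (sym (regroup (+ j) h (shift t h)))) (≡ₘ-sym a≡ₘb))
      }
      where
      regroup : ∀ J h s → J * h - s ≡ (J - + 1) * h - s + h
      regroup = solve-∀

    w-involutive : ∀ k → w t h j (w t h j k) ≡ k
    w-involutive k =
      trans (trans (w≗swap (w t h j k)) (cong (swap h a b) (w≗swap k))) (swap-involutive IsSwap-w k)

    w-image : ∀ l → Decreasing l → IsShiftedX 0 (λ k → w t h j k ∈Xˡ l)
    w-image l dec = IsShiftedX-cong (λ k → subst (λ z → z ∈Xˡ l ⇔ w t h j k ∈Xˡ l) (w≗swap k) ⇔.refl)
                                    (swap-image IsSwap-w l dec)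

open import Data.Nat using (_≤_; _<_)

lemma4p1 : (t : ℕ) .{{_ : NonZero t}} → 2 ≤ t → (h : ℤ) → Coprime ∣ h ∣ t →
           (λ' : Partition) → (j : ℕ) → j < t →
           ∃[ μ ] ((k : ℤ) → (k ∈wX[ t , h , j ] λ') ⇔ (k ∈X μ))
lemma4p1 t 2≤t h cop λ' j _ with IsShiftedX-zero⇒X (w-image t h j 2≤t cop (parts λ') (decreasing λ'))
... | μ , w∈λ⇔∈μ = μ , λ k → begin
  (k ∈wX[ t , h , j ] λ')  ∼⟨ involution-image (w-involutive t h j 2≤t cop) k ⟩
  w t h j k ∈X λ'          ∼⟨ ∈X⇔∈Xˡ {ν = λ'} ⟩
  w t h j k ∈Xˡ parts λ'   ∼⟨ w∈λ⇔∈μ k ⟩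
  k ∈X μ                   ∎
  where open EquationalReasoning
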